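{- Let $R,\Lambda$ be positive integers and $w$ a positive integer. Suppose there exists a $\mathrm{DK}(R,\Lambda)$-design on $V$ points with $B$ blocks such that the size of every block is congruent to $w-1$ modulo $w$. Suppose furthermore that at least one of $RB$ or $B^2$ is not divisible by $w$. Then there exists a type-maximal set of $V$ mutually orthogonal binary frequency squares of type $(B+VR;\,B+VR-R,\,R)$.
   Context: A design is a pair $(\mathcal{V},\mathcal{B})$ with $\mathcal{V}$ a finite set of points and $\mathcal{B}$ a collection (multiset; repeated and empty blocks allowed) of subsets of $\mathcal{V}$. A $\mathrm{DK}(R,\Lambda)$-design is a design in which every pair of distinct points occurs in exactly $\Lambda$ blocks, every point occurs in exactly $R$ blocks, and $R^2=\Lambda|\mathcal{B}|$. A frequency square of type $(N;\mu_0,\dots,\mu_{m-1})$ ($m\ge2$, $\mu_i\ge1$) is an $N\times N$ array on symbols $\{0,\dots,m-1\}$ where symbol $i$ occurs exactly $\mu_i$ times in each row and column; binary means $m=2$. Two frequency squares of types $(N;\mu_0,\dots)$ and $(N;\nu_0,\dots)$ are orthogonal if each ordered pair $(i,j)$ occurs exactly $\mu_i\nu_j$ times when superimposed. A set $\{F_1,\dots,F_k\}$ of mutually (pairwise) orthogonal frequency squares is type-maximal if there is no frequency square $F$ orthogonal to every $F_i$ and of the same type as some $F_t$. -}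

module Defs where

open import Data.Nat using (ℕ; zero; suc; _+_; _*_; _∸_; _≤_)
open import Data.Nat.Divisibility using (_∣_)
open import Data.Bool using (Bool; true; false; _∧_)
open import Data.Fin using (Fin; zero; suc)
open import Data.Fin.Properties using (_≟_)
open import Data.Product using (Σ; _×_)
open import Relation.Nullary using (¬_)
open import Relation.Nullary.Decidable using (⌊_⌋)
open import Relation.Binary.PropositionalEquality using (_≡_; _≢_)

bit : Bool → ℕ
bit true  = 1
bit false = 0

count : (n : ℕ) → (Fin n → Bool) → ℕ
count zero    p = 0
count (suc n) p = bit (p zero) + count n (λ i → p (suc i))

-- A design on V points with B blocks is given by its incidence
-- function  inc : Fin B → Fin V → Bool  (block b contains point x iff
-- inc b x = true).  Indexing blocks by Fin B makes 𝓑 a multiset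
-- (repeated and empty blocks allowed).

blockSize : {V B : ℕ} → (Fin B → Fin V → Bool) → Fin B → ℕ
blockSize {V} inc b = count V (inc b)

IsDK : (V B R Λ : ℕ) → (Fin B → Fin V → Bool) → Set
IsDK V B R Λ inc =
    (∀ (x : Fin V) → count B (λ b → inc b x) ≡ R)
  × (∀ (x y : Fin V) → x ≢ y → count B (λ b → inc b x ∧ inc b y) ≡ Λ)
  × (R * R ≡ Λ * B)

Square : ℕ → ℕ → Set
Square N m = Fin N → Fin N → Fin m

IsFreqSquare : (N m : ℕ) → (Fin m → ℕ) → Square N m → Set
IsFreqSquare N m μ F =
    (2 ≤ m)
  × (∀ (i : Fin m) → 1 ≤ μ i)
  × (∀ (r : Fin N) (i : Fin m) → count N (λ c → ⌊ F r c ≟ i ⌋) ≡ μ i)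
  × (∀ (c : Fin N) (i : Fin m) → count N (λ r → ⌊ F r c ≟ i ⌋) ≡ μ i)

sumFin : (n : ℕ) → (Fin n → ℕ) → ℕ
sumFin zero    f = 0
sumFin (suc n) f = f zero + sumFin n (λ i → f (suc i))

countCells : (N : ℕ) → (Fin N → Fin N → Bool) → ℕ
countCells N P = sumFin N (λ r → count N (P r))

Orthogonal : {N m m' : ℕ} → (Fin m → ℕ) → (Fin m' → ℕ) → Square N m → Square N m' → Set
Orthogonal {N} {m} {m'} μ ν F G =
  ∀ (i : Fin m) (j : Fin m') →
    countCells N (λ r c → ⌊ F r c ≟ i ⌋ ∧ ⌊ G r c ≟ j ⌋) ≡ μ i * ν j

IsMOFS : (N m : ℕ) → (Fin m → ℕ) → (k : ℕ) → (Fin k → Square N m) → Set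
IsMOFS N m μ k Fs =
    (∀ (t : Fin k) → IsFreqSquare N m μ (Fs t))
  × (∀ (s t : Fin k) → s ≢ t → Orthogonal μ μ (Fs s) (Fs t))

-- Since every F_t has type (N; μ), "of the same type as some F_t" means:
-- some index t : Fin k exists and F has type (N; μ).
TypeMaximal : (N m : ℕ) → (Fin m → ℕ) → (k : ℕ) → (Fin k → Square N m) → Set
TypeMaximal N m μ k Fs =
  ¬ (Σ (Fin k) λ t → Σ (Square N m) λ F →
        IsFreqSquare N m μ F × (∀ (i : Fin k) → Orthogonal μ μ F (Fs i)))

binaryType : (N R : ℕ) → Fin 2 → ℕ
binaryType N R zero       = N ∸ R
binaryType N R (suc zero) = R

-- Index the rows and columns of an N × N array, N = B + V R, by the B blocks followed by R
-- copies of each point; put the block i + j (mod B) in cell (i, j) of the top-left B × B part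
-- and the point u + v (mod V) in cell (u, v) of the bottom-right part. The square F_x marks the
-- cells containing x. Its rows and columns have R ones because every point lies in R blocks, and
-- F_x, F_y share B Λ = R² ones because two points lie together in Λ blocks.
--
-- Let A be a binary square of the same type orthogonal to every F_x. Summing these orthogonality
-- conditions over x weighs each one of A by the number of points in its cell. Comparing with the
-- row sums of A on the top rows and its column sums on the bottom columns gives
-- Σ A(i, j) (|block (i + j)| + 1) = B R over the top-left part, so w ∣ B R. Counting incidences,
-- w also divides Σ_b (|b| + 1) = V R + B, hence B (V R + B) = V (B R) + B², and so B².

module Submission where

open import Defs
open import Data.Nat using (ℕ; zero; suc; _+_; _*_; _∸_; _≤_; z≤n; s≤s; NonZero)
open import Data.Nat.Properties
  using (+-comm; +-assoc; +-suc; +-identityʳ; *-comm; *-assoc; *-zeroʳ; *-identityʳ;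
         *-distribˡ-+; *-distribˡ-∸; *-distribʳ-∸; +-cancelˡ-≡; +-cancelʳ-≡; m+n∸n≡m; m+n∸m≡n;
         +-∸-assoc; m≤m+n; m≤n*m; ≤-trans; +-*-semiring; *-commutativeSemigroup)
open import Data.Nat.DivMod using (_mod_; [m+n]%n≡m%n; m<n⇒m%n≡m)
open import Data.Nat.Divisibility using (_∣_; _∣0; ∣m∣n⇒∣m+n; ∣n⇒∣m*n; ∣m+n∣m⇒∣n)
open import Data.Bool using (Bool; true; false; _∧_; not)
open import Data.Bool.Properties using (∧-comm)
open import Data.Fin using (Fin; zero; suc; toℕ; _↑ˡ_; _↑ʳ_; splitAt; quotient)
open import Data.Fin.Properties
  using (_≟_; nonZeroIndex; toℕ<n; toℕ-inject₁; toℕ-fromℕ; fromℕ<-cong; fromℕ<-toℕ; splitAt-↑ˡ; splitAt-↑ʳ)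
open import Data.Vec.Functional using (init; last)
open import Data.Product using (Σ; _×_; _,_)
open import Data.Sum using (_⊎_; inj₁; inj₂; [_,_]′)
import Data.Sum as Sum
open import Function using (_∘_)
open import Relation.Nullary using (¬_)
open import Data.Empty using (⊥-elim)
open import Relation.Nullary.Decidable using (⌊_⌋; yes; no; ⌊⌋-map′)
open import Relation.Binary.PropositionalEquality
open import Algebra.Properties.Semiring.Sum +-*-semiring
  using (sum; sum-cong-≗; sum-init-last; ∑-comm; ∑-distrib-+; *-distribˡ-sum)

open import Algebra.Properties.CommutativeSemigroup *-commutativeSemigroup using (x∙yz≈y∙xz)

open ≡-Reasoning

sumFin≡sum : ∀ n (f : Fin n → ℕ) → sumFin n f ≡ sum f
sumFin≡sum zero    f = refl
sumFin≡sum (suc n) f = cong (f zero +_) (sumFin≡sum n (f ∘ suc))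

count≡sum : ∀ n (p : Fin n → Bool) → count n p ≡ sum (bit ∘ p)
count≡sum zero    p = refl
count≡sum (suc n) p = cong (bit (p zero) +_) (count≡sum n (p ∘ suc))

countCells≡sum : ∀ N (P : Fin N → Fin N → Bool) →
  countCells N P ≡ sum (λ r → sum (λ c → bit (P r c)))
countCells≡sum N P = trans (sumFin≡sum N _) (sum-cong-≗ (λ r → count≡sum N (P r)))

sum-const : ∀ n x → sum {n} (λ _ → x) ≡ n * x
sum-const zero    x = refl
sum-const (suc n) x = cong (x +_) (sum-const n x)

sum-zero : ∀ n {f : Fin n → ℕ} → (∀ i → f i ≡ 0) → sum f ≡ 0
sum-zero n f≗0 = trans (sum-cong-≗ f≗0) (trans (sum-const n 0) (*-zeroʳ n))

sum-↑ : ∀ m {n} (f : Fin (m + n) → ℕ) →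
  sum f ≡ sum (λ i → f (i ↑ˡ n)) + sum (λ j → f (m ↑ʳ j))
sum-↑ zero    f = refl
sum-↑ (suc m) f = trans (cong (f zero +_) (sum-↑ m (f ∘ suc))) (sym (+-assoc (f zero) _ _))

quotient-↑ˡ : ∀ {m} n (i : Fin n) → quotient {suc m} n (i ↑ˡ m * n) ≡ zero
quotient-↑ˡ {m} n i rewrite splitAt-↑ˡ n i (m * n) = refl

quotient-↑ʳ : ∀ {m} n (j : Fin (m * n)) → quotient {suc m} n (n ↑ʳ j) ≡ suc (quotient n j)
quotient-↑ʳ {m} n j rewrite splitAt-↑ʳ n (m * n) j = refl

sum-quotient : ∀ m n (h : Fin m → ℕ) → sum (h ∘ quotient {m} n) ≡ n * sum h
sum-quotient zero    n h = sym (*-zeroʳ n)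
sum-quotient (suc m) n h = begin
  sum (h ∘ quotient n)
    ≡⟨ sum-↑ n (h ∘ quotient n) ⟩
  sum (λ i → h (quotient n (i ↑ˡ m * n))) + sum (λ j → h (quotient n (n ↑ʳ j)))
    ≡⟨ cong₂ _+_ (sum-cong-≗ (cong h ∘ quotient-↑ˡ n)) (sum-cong-≗ (cong h ∘ quotient-↑ʳ n)) ⟩
  sum {n} (λ _ → h zero) + sum (λ j → h (suc (quotient {m} n j)))
    ≡⟨ cong₂ _+_ (sum-const n (h zero)) (sum-quotient m n (h ∘ suc)) ⟩
  n * h zero + n * sum (h ∘ suc)
    ≡⟨ *-distribˡ-+ n (h zero) _ ⟨
  n * sum h ∎

∣-sum : ∀ {d n} {f : Fin n → ℕ} → (∀ i → d ∣ f i) → d ∣ sum f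
∣-sum {d} {zero}  d∣f = d ∣0
∣-sum {d} {suc n} d∣f = ∣m∣n⇒∣m+n (d∣f zero) (∣-sum (d∣f ∘ suc))

infixl 6 _⊕_

_⊕_ : ∀ {n} → Fin n → Fin n → Fin n
_⊕_ {suc n} i j = (toℕ i + toℕ j) mod suc n

⊕-comm : ∀ {n} (i j : Fin n) → i ⊕ j ≡ j ⊕ i
⊕-comm {suc n} i j = cong (_mod suc n) (+-comm (toℕ i) (toℕ j))

toℕ-mod : ∀ {n} (j : Fin (suc n)) → toℕ j mod suc n ≡ j
toℕ-mod {n} j = trans (fromℕ<-cong _ _ (m<n⇒m%n≡m (toℕ<n j)) _ (toℕ<n j)) (fromℕ<-toℕ j _)

+-mod : ∀ k n → (k + suc n) mod suc n ≡ k mod suc n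
+-mod k n = fromℕ<-cong _ _ ([m+n]%n≡m%n k (suc n)) _ _

private
  module CyclicShift {n : ℕ} (g : Fin (suc n) → ℕ) where

    h : ℕ → ℕ
    h k = g (k mod suc n)

    shiftedSum : ℕ → ℕ
    shiftedSum a = sum (λ (j : Fin (suc n)) → h (a + toℕ j))

    -- Split the sum of h over a, …, a + n + 1 at either end; h (a + n + 1) = h a by periodicity.
    shiftedSum-suc : ∀ a → shiftedSum (suc a) ≡ shiftedSum a
    shiftedSum-suc a = +-cancelˡ-≡ (h a) _ _ (begin
      h a + shiftedSum (suc a)
        ≡⟨ cong₂ _+_ (cong h (+-identityʳ a)) (sum-cong-≗ {suc n} (λ j → cong h (+-suc a (toℕ j)))) ⟨
      sum t
        ≡⟨ sum-init-last t ⟩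
      sum (init t) + last t
        ≡⟨ cong₂ _+_ (sum-cong-≗ {suc n} (λ j → cong (h ∘ (a +_)) (toℕ-inject₁ j)))
                     (trans (cong (h ∘ (a +_)) (toℕ-fromℕ (suc n))) (cong g (+-mod a n))) ⟩
      shiftedSum a + h a
        ≡⟨ +-comm (shiftedSum a) (h a) ⟩
      h a + shiftedSum a ∎)
      where
      t : Fin (suc (suc n)) → ℕ
      t k = h (a + toℕ k)

    shiftedSum≡sum : ∀ a → shiftedSum a ≡ sum g
    shiftedSum≡sum zero    = sum-cong-≗ (cong g ∘ toℕ-mod)
    shiftedSum≡sum (suc a) = trans (shiftedSum-suc a) (shiftedSum≡sum a)

sum-⊕ : ∀ {n} (g : Fin n → ℕ) (i : Fin n) → sum (λ j → g (i ⊕ j)) ≡ sum g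
sum-⊕ {suc n} g i = CyclicShift.shiftedSum≡sum g (toℕ i)

bit-∧ : ∀ p q → bit (p ∧ q) ≡ bit p * bit q
bit-∧ true  true  = refl
bit-∧ true  false = refl
bit-∧ false q     = refl

bit-not : ∀ p → bit (not p) + bit p ≡ 1
bit-not true  = refl
bit-not false = refl

bit-∧-not : ∀ p q → bit (p ∧ q) + bit (p ∧ not q) ≡ bit p
bit-∧-not true  true  = refl
bit-∧-not true  false = refl
bit-∧-not false q     = refl

sum-≟ˡ : ∀ {n} (x : Fin n) → sum (λ z → bit ⌊ z ≟ x ⌋) ≡ 1
sum-≟ˡ {suc n} zero    = cong suc (sum-zero n (λ _ → refl))
sum-≟ˡ {suc n} (suc x) = trans (sum-cong-≗ (λ z → cong bit (⌊⌋-map′ _ _ (z ≟ x)))) (sum-≟ˡ x)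

sum-≟ʳ : ∀ {n} (z : Fin n) → sum (λ x → bit ⌊ z ≟ x ⌋) ≡ 1
sum-≟ʳ {suc n} zero    = cong suc (sum-zero n (λ _ → refl))
sum-≟ʳ {suc n} (suc z) = trans (sum-cong-≗ (λ x → cong bit (⌊⌋-map′ _ _ (z ≟ x)))) (sum-≟ʳ z)

count-false : ∀ n → count n (λ _ → false) ≡ 0
count-false zero    = refl
count-false (suc n) = count-false n

count-not+count : ∀ n (p : Fin n → Bool) → count n (not ∘ p) + count n p ≡ n
count-not+count n p = begin
  count n (not ∘ p) + count n p            ≡⟨ cong₂ _+_ (count≡sum n (not ∘ p)) (count≡sum n p) ⟩
  sum (bit ∘ not ∘ p) + sum (bit ∘ p)      ≡⟨ ∑-distrib-+ (bit ∘ not ∘ p) (bit ∘ p) ⟨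
  sum (λ i → bit (not (p i)) + bit (p i))  ≡⟨ sum-cong-≗ (bit-not ∘ p) ⟩
  sum {n} (λ _ → 1)                        ≡⟨ sum-const n 1 ⟩
  n * 1                                    ≡⟨ *-identityʳ n ⟩
  n                                        ∎

count-not : ∀ n (p : Fin n → Bool) → count n (not ∘ p) ≡ n ∸ count n p
count-not n p = trans (sym (m+n∸n≡m (count n (not ∘ p)) (count n p))) (cong (_∸ count n p) (count-not+count n p))

count-cong : ∀ n {p q : Fin n → Bool} → (∀ i → p i ≡ q i) → count n p ≡ count n q
count-cong n {p} {q} p≗q = begin
  count n p       ≡⟨ count≡sum n p ⟩
  sum (bit ∘ p)   ≡⟨ sum-cong-≗ (cong bit ∘ p≗q) ⟩
  sum (bit ∘ q)   ≡⟨ count≡sum n q ⟨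
  count n q       ∎

countCells-cong : ∀ N {P Q : Fin N → Fin N → Bool} →
  (∀ r c → P r c ≡ Q r c) → countCells N P ≡ countCells N Q
countCells-cong N {P} {Q} P≗Q = begin
  countCells N P                       ≡⟨ countCells≡sum N P ⟩
  sum (λ r → sum (λ c → bit (P r c)))  ≡⟨ sum-cong-≗ (λ r → sum-cong-≗ (cong bit ∘ P≗Q r)) ⟩
  sum (λ r → sum (λ c → bit (Q r c)))  ≡⟨ countCells≡sum N Q ⟨
  countCells N Q                       ∎

countCells-rows : ∀ N {k} {P : Fin N → Fin N → Bool} →
  (∀ r → count N (P r) ≡ k) → countCells N P ≡ N * k
countCells-rows N {k} rows = trans (sumFin≡sum N _) (trans (sum-cong-≗ rows) (sum-const N k))

countCells-∧-not : ∀ N (P Q : Fin N → Fin N → Bool) →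
  countCells N (λ r c → P r c ∧ Q r c) + countCells N (λ r c → P r c ∧ not (Q r c)) ≡ countCells N P
countCells-∧-not N P Q = begin
  countCells N (λ r c → P r c ∧ Q r c) + countCells N (λ r c → P r c ∧ not (Q r c))
    ≡⟨ cong₂ _+_ (countCells≡sum N _) (countCells≡sum N _) ⟩
  sum (λ r → sum (λ c → bit (P r c ∧ Q r c))) + sum (λ r → sum (λ c → bit (P r c ∧ not (Q r c))))
    ≡⟨ ∑-distrib-+ {N} _ _ ⟨
  sum (λ r → sum (λ c → bit (P r c ∧ Q r c)) + sum (λ c → bit (P r c ∧ not (Q r c))))
    ≡⟨ sum-cong-≗ {N} (λ r → ∑-distrib-+ {N} _ _) ⟨
  sum (λ r → sum (λ c → bit (P r c ∧ Q r c) + bit (P r c ∧ not (Q r c))))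
    ≡⟨ sum-cong-≗ (λ r → sum-cong-≗ (λ c → bit-∧-not (P r c) (Q r c))) ⟩
  sum (λ r → sum (λ c → bit (P r c)))
    ≡⟨ countCells≡sum N P ⟨
  countCells N P ∎

fromBool : Bool → Fin 2
fromBool false = zero
fromBool true  = suc zero

binarySquare : ∀ {N} → (Fin N → Fin N → Bool) → Square N 2
binarySquare a r c = fromBool (a r c)

literal : Fin 2 → Bool → Bool
literal zero       b = not b
literal (suc zero) b = b

⌊fromBool≟⌋ : ∀ b i → ⌊ fromBool b ≟ i ⌋ ≡ literal i b
⌊fromBool≟⌋ false zero       = refl
⌊fromBool≟⌋ false (suc zero) = refl
⌊fromBool≟⌋ true  zero       = refl
⌊fromBool≟⌋ true  (suc zero) = refl

count-literal : ∀ {N R} (p : Fin N → Bool) → count N p ≡ R →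
  ∀ i → count N (literal i ∘ p) ≡ binaryType N R i
count-literal {N} p count≡R zero       = trans (count-not N p) (cong (N ∸_) count≡R)
count-literal     p count≡R (suc zero) = count≡R

binarySquare-isFreqSquare : ∀ {N R} (a : Fin N → Fin N → Bool) → 1 ≤ R → 1 ≤ N ∸ R →
  (∀ r → count N (a r) ≡ R) → (∀ c → count N (λ r → a r c) ≡ R) →
  IsFreqSquare N 2 (binaryType N R) (binarySquare a)
binarySquare-isFreqSquare {N} {R} a 1≤R 1≤N∸R rows cols =
  s≤s (s≤s z≤n) , positive , rowCounts , columnCounts
  where
  positive : ∀ i → 1 ≤ binaryType N R i
  positive zero       = 1≤N∸R
  positive (suc zero) = 1≤R

  rowCounts : ∀ r i → count N (λ c → ⌊ binarySquare a r c ≟ i ⌋) ≡ binaryType N R i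
  rowCounts r i = trans (count-cong N (λ c → ⌊fromBool≟⌋ (a r c) i)) (count-literal (a r) (rows r) i)

  columnCounts : ∀ c i → count N (λ r → ⌊ binarySquare a r c ≟ i ⌋) ≡ binaryType N R i
  columnCounts c i = trans (count-cong N (λ r → ⌊fromBool≟⌋ (a r c) i)) (count-literal (λ r → a r c) (cols c) i)

binarySquare-orthogonal : ∀ {N R} (a b : Fin N → Fin N → Bool) →
  (∀ r → count N (a r) ≡ R) → (∀ r → count N (b r) ≡ R) →
  countCells N (λ r c → a r c ∧ b r c) ≡ R * R →
  Orthogonal (binaryType N R) (binaryType N R) (binarySquare a) (binarySquare b)
binarySquare-orthogonal {N} {R} a b rowsA rowsB cells[a∧b] i j =
  trans (countCells-cong N (λ r c → cong₂ _∧_ (⌊fromBool≟⌋ (a r c) i) (⌊fromBool≟⌋ (b r c) j)))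
        (literalCounts i j)
  where
  cells : (Fin N → Fin N → Bool) → ℕ
  cells = countCells N

  cells-∧-not : ∀ P Q → cells (λ r c → P r c ∧ not (Q r c)) ≡ cells P ∸ cells (λ r c → P r c ∧ Q r c)
  cells-∧-not P Q = trans (sym (m+n∸m≡n (cells (λ r c → P r c ∧ Q r c)) _))
                          (cong (_∸ cells (λ r c → P r c ∧ Q r c)) (countCells-∧-not N P Q))

  cells[b∧a] : cells (λ r c → b r c ∧ a r c) ≡ R * R
  cells[b∧a] = trans (countCells-cong N (λ r c → ∧-comm (b r c) (a r c))) cells[a∧b]

  literalCounts : ∀ i j →
    cells (λ r c → literal i (a r c) ∧ literal j (b r c)) ≡ binaryType N R i * binaryType N R j
  literalCounts (suc zero) (suc zero) = cells[a∧b]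
  literalCounts (suc zero) zero = begin
    cells (λ r c → a r c ∧ not (b r c))  ≡⟨ cells-∧-not a b ⟩
    cells a ∸ cells (λ r c → a r c ∧ b r c) ≡⟨ cong₂ _∸_ (countCells-rows N rowsA) cells[a∧b] ⟩
    N * R ∸ R * R                         ≡⟨ cong (_∸ R * R) (*-comm N R) ⟩
    R * N ∸ R * R                         ≡⟨ *-distribˡ-∸ R N R ⟨
    R * (N ∸ R)                           ∎
  literalCounts zero (suc zero) = begin
    cells (λ r c → not (a r c) ∧ b r c)   ≡⟨ countCells-cong N (λ r c → ∧-comm (not (a r c)) (b r c)) ⟩
    cells (λ r c → b r c ∧ not (a r c))   ≡⟨ cells-∧-not b a ⟩
    cells b ∸ cells (λ r c → b r c ∧ a r c) ≡⟨ cong₂ _∸_ (countCells-rows N rowsB) cells[b∧a] ⟩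
    N * R ∸ R * R                         ≡⟨ *-distribʳ-∸ R N R ⟨
    (N ∸ R) * R                           ∎
  literalCounts zero zero = begin
    cells (λ r c → not (a r c) ∧ not (b r c))
      ≡⟨ cells-∧-not (λ r c → not (a r c)) b ⟩
    cells (λ r c → not (a r c)) ∸ cells (λ r c → not (a r c) ∧ b r c)
      ≡⟨ cong₂ _∸_ (countCells-rows N (λ r → count-literal (a r) (rowsA r) zero)) (literalCounts zero (suc zero)) ⟩
    N * (N ∸ R) ∸ (N ∸ R) * R
      ≡⟨ cong (_∸ (N ∸ R) * R) (*-comm N (N ∸ R)) ⟩
    (N ∸ R) * N ∸ (N ∸ R) * R
      ≡⟨ *-distribˡ-∸ (N ∸ R) N R ⟨
    (N ∸ R) * (N ∸ R) ∎

sum-blockSize : ∀ {V B R} (inc : Fin B → Fin V → Bool) →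
  (∀ x → count B (λ b → inc b x) ≡ R) → sum (blockSize inc) ≡ V * R
sum-blockSize {V} {B} {R} inc replication = begin
  sum (blockSize inc)                    ≡⟨ sum-cong-≗ (λ b → count≡sum V (inc b)) ⟩
  sum (λ b → sum (λ x → bit (inc b x)))  ≡⟨ ∑-comm (λ b x → bit (inc b x)) ⟩
  sum (λ x → sum (λ b → bit (inc b x)))  ≡⟨ sum-cong-≗ (λ x → trans (sym (count≡sum B _)) (replication x)) ⟩
  sum {V} (λ _ → R)                      ≡⟨ sum-const V R ⟩
  V * R                                  ∎

∣B*R⇒∣B*B : ∀ {V B R w} (inc : Fin B → Fin V → Bool) →
  (∀ x → count B (λ b → inc b x) ≡ R) → (∀ b → w ∣ blockSize inc b + 1) →
  w ∣ B * R → w ∣ B * B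
∣B*R⇒∣B*B {V} {B} {R} {w} inc replication w∣size+1 w∣B*R =
  ∣m+n∣m⇒∣n (subst (w ∣_) B*[V*R+B] (∣n⇒∣m*n B w∣V*R+B)) (∣n⇒∣m*n V w∣B*R)
  where
  sum[size+1] : sum (λ b → blockSize inc b + 1) ≡ V * R + B
  sum[size+1] = begin
    sum (λ b → blockSize inc b + 1)      ≡⟨ ∑-distrib-+ (blockSize inc) (λ _ → 1) ⟩
    sum (blockSize inc) + sum {B} (λ _ → 1) ≡⟨ cong₂ _+_ (sum-blockSize inc replication) (sum-const B 1) ⟩
    V * R + B * 1                        ≡⟨ cong (V * R +_) (*-identityʳ B) ⟩
    V * R + B                            ∎

  w∣V*R+B : w ∣ V * R + B
  w∣V*R+B = subst (w ∣_) sum[size+1] (∣-sum w∣size+1)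

  B*[V*R+B] : B * (V * R + B) ≡ V * (B * R) + B * B
  B*[V*R+B] = begin
    B * (V * R + B)       ≡⟨ *-distribˡ-+ B (V * R) B ⟩
    B * (V * R) + B * B   ≡⟨ cong (_+ B * B) (x∙yz≈y∙xz B V R) ⟩
    V * (B * R) + B * B   ∎

R*R≡Λ*B⇒1≤B : ∀ {R} Λ B → 1 ≤ R → R * R ≡ Λ * B → 1 ≤ B
R*R≡Λ*B⇒1≤B     Λ (suc _) _ _ = s≤s z≤n
R*R≡Λ*B⇒1≤B {suc _} Λ zero _ R*R≡Λ*0 with trans R*R≡Λ*0 (*-zeroʳ Λ)
... | ()

1≤B+V*R∸R : ∀ {B} V R .{{_ : NonZero V}} → 1 ≤ B → 1 ≤ B + V * R ∸ R
1≤B+V*R∸R {B} V R 1≤B =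
  ≤-trans 1≤B (subst (B ≤_) (sym (+-∸-assoc B (m≤n*m R V))) (m≤m+n B (V * R ∸ R)))

module Construction {B V : ℕ} (R : ℕ) (inc : Fin B → Fin V → Bool) where

  N : ℕ
  N = B + V * R

  Class : Set
  Class = Fin B ⊎ Fin V

  -- Rows and columns B + (u R + s) with s < R form the class inj₂ u.
  class : Fin N → Class
  class r = Sum.map₂ (quotient R) (splitAt B r)

  top : Fin B → Fin N
  top i = i ↑ˡ V * R

  bottom : Fin (V * R) → Fin N
  bottom k = B ↑ʳ k

  class-top : ∀ i → class (top i) ≡ inj₁ i
  class-top i = cong (Sum.map₂ (quotient R)) (splitAt-↑ˡ B i (V * R))

  class-bottom : ∀ k → class (bottom k) ≡ inj₂ (quotient R k)
  class-bottom k = cong (Sum.map₂ (quotient R)) (splitAt-↑ʳ B (V * R) k)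

  sum-class : ∀ (g : Class → ℕ) → sum (g ∘ class) ≡ sum (g ∘ inj₁) + R * sum (g ∘ inj₂)
  sum-class g = begin
    sum (g ∘ class)                                        ≡⟨ sum-↑ B (g ∘ class) ⟩
    sum (g ∘ class ∘ top) + sum (g ∘ class ∘ bottom)       ≡⟨ cong₂ _+_ (sum-cong-≗ (cong g ∘ class-top))
                                                                         (sum-cong-≗ (cong g ∘ class-bottom)) ⟩
    sum (g ∘ inj₁) + sum (g ∘ inj₂ ∘ quotient R)           ≡⟨ cong (sum (g ∘ inj₁) +_) (sum-quotient V R (g ∘ inj₂)) ⟩
    sum (g ∘ inj₁) + R * sum (g ∘ inj₂)                    ∎

  singleton : Fin V → Fin V → Bool
  singleton z x = ⌊ z ≟ x ⌋

  classCell : Class → Class → Fin V → Bool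
  classCell (inj₁ i) (inj₁ j) = inc (i ⊕ j)
  classCell (inj₂ u) (inj₂ v) = singleton (u ⊕ v)
  classCell (inj₁ _) (inj₂ _) = λ _ → false
  classCell (inj₂ _) (inj₁ _) = λ _ → false

  classCell-comm : ∀ k l → classCell k l ≡ classCell l k
  classCell-comm (inj₁ i) (inj₁ j) = cong inc (⊕-comm i j)
  classCell-comm (inj₂ u) (inj₂ v) = cong singleton (⊕-comm u v)
  classCell-comm (inj₁ _) (inj₂ _) = refl
  classCell-comm (inj₂ _) (inj₁ _) = refl

  cell : Fin N → Fin N → Fin V → Bool
  cell r c = classCell (class r) (class c)

  square : Fin V → Fin N → Fin N → Bool
  square x r c = cell r c x

  cell-top-top : ∀ i j → cell (top i) (top j) ≡ inc (i ⊕ j)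
  cell-top-top i j = cong₂ classCell (class-top i) (class-top j)

  cell-top-bottom : ∀ i l → cell (top i) (bottom l) ≡ (λ _ → false)
  cell-top-bottom i l = cong₂ classCell (class-top i) (class-bottom l)

  cell-bottom-top : ∀ k j → cell (bottom k) (top j) ≡ (λ _ → false)
  cell-bottom-top k j = cong₂ classCell (class-bottom k) (class-top j)

  count-cell-bottom-bottom : ∀ k l → count V (cell (bottom k) (bottom l)) ≡ 1
  count-cell-bottom-bottom k l = begin
    count V (cell (bottom k) (bottom l))  ≡⟨ cong (count V) (cong₂ classCell (class-bottom k) (class-bottom l)) ⟩
    count V (singleton z)                 ≡⟨ count≡sum V (singleton z) ⟩
    sum (bit ∘ singleton z)               ≡⟨ sum-≟ʳ z ⟩
    1                                     ∎
    where
    z : Fin V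
    z = quotient R k ⊕ quotient R l

  rowTotal : ((Fin V → Bool) → ℕ) → Class → ℕ
  rowTotal f (inj₁ _) = sum (f ∘ inc)
  rowTotal f (inj₂ _) = R * sum (f ∘ singleton)

  sum-row : ∀ (f : (Fin V → Bool) → ℕ) → f (λ _ → false) ≡ 0 →
    ∀ k → sum (λ c → f (classCell k (class c))) ≡ rowTotal f k
  sum-row f f∅≡0 (inj₁ i) = begin
    sum (λ c → f (classCell (inj₁ i) (class c)))  ≡⟨ sum-class (f ∘ classCell (inj₁ i)) ⟩
    sum (λ j → f (inc (i ⊕ j))) + R * sum {V} (λ _ → f (λ _ → false))
      ≡⟨ cong₂ _+_ (sum-⊕ (f ∘ inc) i) (cong (R *_) (sum-zero V (λ _ → f∅≡0))) ⟩
    sum (f ∘ inc) + R * 0                         ≡⟨ cong (sum (f ∘ inc) +_) (*-zeroʳ R) ⟩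
    sum (f ∘ inc) + 0                             ≡⟨ +-identityʳ _ ⟩
    sum (f ∘ inc)                                 ∎
  sum-row f f∅≡0 (inj₂ u) = begin
    sum (λ c → f (classCell (inj₂ u) (class c)))  ≡⟨ sum-class (f ∘ classCell (inj₂ u)) ⟩
    sum {B} (λ _ → f (λ _ → false)) + R * sum (λ v → f (singleton (u ⊕ v)))
      ≡⟨ cong₂ _+_ (sum-zero B (λ _ → f∅≡0)) (cong (R *_) (sum-⊕ (f ∘ singleton) u)) ⟩
    R * sum (f ∘ singleton)                       ∎

  module _ (replication : ∀ x → count B (λ b → inc b x) ≡ R) where

    square-rows : ∀ x r → count N (square x r) ≡ R
    square-rows x r = begin
      count N (square x r)                        ≡⟨ count≡sum N (square x r) ⟩
      sum (λ c → bit (classCell (class r) (class c) x)) ≡⟨ sum-row (λ S → bit (S x)) refl (class r) ⟩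
      rowTotal (λ S → bit (S x)) (class r)        ≡⟨ rowTotal-point (class r) ⟩
      R                                           ∎
      where
      rowTotal-point : ∀ k → rowTotal (λ S → bit (S x)) k ≡ R
      rowTotal-point (inj₁ _) = trans (sym (count≡sum B (λ b → inc b x))) (replication x)
      rowTotal-point (inj₂ _) = trans (cong (R *_) (sum-≟ˡ x)) (*-identityʳ R)

    square-columns : ∀ x c → count N (λ r → square x r c) ≡ R
    square-columns x c =
      trans (count-cong N (λ r → cong (λ S → S x) (classCell-comm (class r) (class c)))) (square-rows x c)

  square-pairs : ∀ {Λ x y} → x ≢ y → count B (λ b → inc b x ∧ inc b y) ≡ Λ → R * R ≡ Λ * B →
    countCells N (λ r c → square x r c ∧ square y r c) ≡ R * R
  square-pairs {Λ} {x} {y} x≢y pairs R*R≡Λ*B = begin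
    countCells N (λ r c → square x r c ∧ square y r c)  ≡⟨ countCells≡sum N _ ⟩
    sum (λ r → sum (λ c → both (cell r c)))             ≡⟨ sum-cong-≗ (sum-row both refl ∘ class) ⟩
    sum (rowTotal both ∘ class)                         ≡⟨ sum-class (rowTotal both) ⟩
    sum {B} (λ _ → sum (both ∘ inc)) + R * sum {V} (λ _ → R * sum (both ∘ singleton))
      ≡⟨ cong₂ _+_ (sum-const B _) (cong (R *_) (sum-zero V (λ _ → bottomTotal≡0))) ⟩
    B * sum (both ∘ inc) + R * 0                        ≡⟨ cong₂ _+_ (cong (B *_) topTotal≡Λ) (*-zeroʳ R) ⟩
    B * Λ + 0                                           ≡⟨ +-identityʳ (B * Λ) ⟩
    B * Λ                                               ≡⟨ *-comm B Λ ⟩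
    Λ * B                                               ≡⟨ R*R≡Λ*B ⟨
    R * R                                               ∎
    where
    both : (Fin V → Bool) → ℕ
    both S = bit (S x ∧ S y)

    singletons-disjoint : ∀ z → (singleton z x ∧ singleton z y) ≡ false
    singletons-disjoint z with z ≟ x | z ≟ y
    ... | yes refl | yes refl = ⊥-elim (x≢y refl)
    ... | yes _    | no _     = refl
    ... | no _     | _        = refl

    topTotal≡Λ : sum (both ∘ inc) ≡ Λ
    topTotal≡Λ = trans (sym (count≡sum B _)) pairs

    bottomTotal≡0 : R * sum (both ∘ singleton) ≡ 0
    bottomTotal≡0 = trans (cong (R *_) (sum-zero V (cong bit ∘ singletons-disjoint))) (*-zeroʳ R)

  module Extension (a : Fin N → Fin N → Bool)
    (rows : ∀ r → count N (a r) ≡ R) (columns : ∀ c → count N (λ r → a r c) ≡ R)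
    (a⊥squares : ∀ x → countCells N (λ r c → a r c ∧ square x r c) ≡ R * R) where

    A : Fin N → Fin N → ℕ
    A r c = bit (a r c)

    topLeft topRight bottomRight weightedTopLeft : ℕ
    topLeft         = sum (λ i → sum (λ j → A (top i) (top j)))
    topRight        = sum (λ i → sum (λ l → A (top i) (bottom l)))
    bottomRight     = sum (λ k → sum (λ l → A (bottom k) (bottom l)))
    weightedTopLeft = sum (λ i → sum (λ j → A (top i) (top j) * blockSize inc (i ⊕ j)))

    top-rows : topLeft + topRight ≡ B * R
    top-rows = begin
      topLeft + topRight                                 ≡⟨ ∑-distrib-+ {B} _ _ ⟨
      sum (λ i → sum (A (top i) ∘ top) + sum (A (top i) ∘ bottom)) ≡⟨ sum-cong-≗ {B} (λ i → sum-↑ B (A (top i))) ⟨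
      sum (λ i → sum (A (top i)))                        ≡⟨ sum-cong-≗ (λ i → trans (sym (count≡sum N (a (top i)))) (rows (top i))) ⟩
      sum {B} (λ _ → R)                                  ≡⟨ sum-const B R ⟩
      B * R                                              ∎

    bottom-columns : topRight + bottomRight ≡ V * R * R
    bottom-columns = begin
      topRight + bottomRight
        ≡⟨ cong₂ _+_ (∑-comm (λ i l → A (top i) (bottom l))) (∑-comm (λ k l → A (bottom k) (bottom l))) ⟩
      sum (λ l → sum (λ i → A (top i) (bottom l))) + sum (λ l → sum (λ k → A (bottom k) (bottom l)))
        ≡⟨ ∑-distrib-+ {V * R} _ _ ⟨
      sum (λ l → sum (λ i → A (top i) (bottom l)) + sum (λ k → A (bottom k) (bottom l)))
        ≡⟨ sum-cong-≗ {V * R} (λ l → sum-↑ B (λ r → A r (bottom l))) ⟨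
      sum (λ l → sum (λ r → A r (bottom l)))
        ≡⟨ sum-cong-≗ (λ l → trans (sym (count≡sum N (λ r → a r (bottom l)))) (columns (bottom l))) ⟩
      sum {V * R} (λ _ → R)
        ≡⟨ sum-const (V * R) R ⟩
      V * R * R ∎

    weight : Fin N → Fin N → ℕ
    weight r c = A r c * count V (cell r c)

    weight-empty : ∀ {r c} → cell r c ≡ (λ _ → false) → weight r c ≡ 0
    weight-empty {r} {c} cell≡∅ = trans (cong (λ S → A r c * count V S) cell≡∅)
                                        (trans (cong (A r c *_) (count-false V)) (*-zeroʳ (A r c)))

    sum-weight-top : ∀ i → sum (weight (top i)) ≡ sum (λ j → A (top i) (top j) * blockSize inc (i ⊕ j))
    sum-weight-top i = begin
      sum (weight (top i))                                    ≡⟨ sum-↑ B (weight (top i)) ⟩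
      sum (weight (top i) ∘ top) + sum (weight (top i) ∘ bottom)
        ≡⟨ cong₂ _+_ (sum-cong-≗ (λ j → cong (λ S → A (top i) (top j) * count V S) (cell-top-top i j)))
                     (sum-zero (V * R) (λ l → weight-empty (cell-top-bottom i l))) ⟩
      sum (λ j → A (top i) (top j) * blockSize inc (i ⊕ j)) + 0 ≡⟨ +-identityʳ _ ⟩
      sum (λ j → A (top i) (top j) * blockSize inc (i ⊕ j))   ∎

    sum-weight-bottom : ∀ k → sum (weight (bottom k)) ≡ sum (A (bottom k) ∘ bottom)
    sum-weight-bottom k = begin
      sum (weight (bottom k))                                 ≡⟨ sum-↑ B (weight (bottom k)) ⟩
      sum (weight (bottom k) ∘ top) + sum (weight (bottom k) ∘ bottom)
        ≡⟨ cong₂ _+_ (sum-zero B (λ j → weight-empty (cell-bottom-top k j)))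
                     (sum-cong-≗ (λ l → trans (cong (A (bottom k) (bottom l) *_) (count-cell-bottom-bottom k l))
                                              (*-identityʳ _))) ⟩
      sum (A (bottom k) ∘ bottom)                             ∎

    sum-orthogonality : sum {V} (λ x → countCells N (λ r c → a r c ∧ square x r c)) ≡ sum (λ r → sum (weight r))
    sum-orthogonality = begin
      sum (λ x → countCells N (λ r c → a r c ∧ square x r c))
        ≡⟨ sum-cong-≗ {V} (λ x → countCells≡sum N _) ⟩
      sum (λ x → sum (λ r → sum (λ c → bit (a r c ∧ cell r c x))))
        ≡⟨ ∑-comm (λ x r → sum (λ c → bit (a r c ∧ cell r c x))) ⟩
      sum (λ r → sum (λ x → sum (λ c → bit (a r c ∧ cell r c x))))
        ≡⟨ sum-cong-≗ (λ r → ∑-comm (λ x c → bit (a r c ∧ cell r c x))) ⟩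
      sum (λ r → sum (λ c → sum (λ x → bit (a r c ∧ cell r c x))))
        ≡⟨ sum-cong-≗ (λ r → sum-cong-≗ (λ c → sum-cong-≗ (λ x → bit-∧ (a r c) (cell r c x)))) ⟩
      sum (λ r → sum (λ c → sum (λ x → A r c * bit (cell r c x))))
        ≡⟨ sum-cong-≗ (λ r → sum-cong-≗ (λ c → *-distribˡ-sum (A r c) (bit ∘ cell r c))) ⟨
      sum (λ r → sum (λ c → A r c * sum (bit ∘ cell r c)))
        ≡⟨ sum-cong-≗ (λ r → sum-cong-≗ (λ c → cong (A r c *_) (count≡sum V (cell r c)))) ⟨
      sum (λ r → sum (weight r)) ∎

    weighted-bottom-right : weightedTopLeft + bottomRight ≡ V * (R * R)
    weighted-bottom-right = begin
      weightedTopLeft + bottomRight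
        ≡⟨ cong₂ _+_ (sum-cong-≗ sum-weight-top) (sum-cong-≗ sum-weight-bottom) ⟨
      sum (sum ∘ weight ∘ top) + sum (sum ∘ weight ∘ bottom)  ≡⟨ sum-↑ B (sum ∘ weight) ⟨
      sum (λ r → sum (weight r))                               ≡⟨ sum-orthogonality ⟨
      sum (λ x → countCells N (λ r c → a r c ∧ square x r c))  ≡⟨ sum-cong-≗ a⊥squares ⟩
      sum {V} (λ _ → R * R)                                    ≡⟨ sum-const V (R * R) ⟩
      V * (R * R)                                              ∎

    weightedTopLeft≡topRight : weightedTopLeft ≡ topRight
    weightedTopLeft≡topRight = +-cancelʳ-≡ bottomRight weightedTopLeft topRight (begin
      weightedTopLeft + bottomRight  ≡⟨ weighted-bottom-right ⟩
      V * (R * R)                    ≡⟨ *-assoc V R R ⟨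
      V * R * R                      ≡⟨ bottom-columns ⟨
      topRight + bottomRight         ∎)

    sum-top-left[size+1] : sum (λ i → sum (λ j → A (top i) (top j) * (blockSize inc (i ⊕ j) + 1))) ≡ B * R
    sum-top-left[size+1] = begin
      sum (λ i → sum (λ j → A (top i) (top j) * (blockSize inc (i ⊕ j) + 1)))
        ≡⟨ sum-cong-≗ (λ i → sum-cong-≗ (λ j → *[n+1] (A (top i) (top j)) (blockSize inc (i ⊕ j)))) ⟩
      sum (λ i → sum (λ j → A (top i) (top j) * blockSize inc (i ⊕ j) + A (top i) (top j)))
        ≡⟨ sum-cong-≗ (λ i → ∑-distrib-+ (λ j → A (top i) (top j) * blockSize inc (i ⊕ j)) (A (top i) ∘ top)) ⟩
      sum (λ i → sum (λ j → A (top i) (top j) * blockSize inc (i ⊕ j)) + sum (A (top i) ∘ top))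
        ≡⟨ ∑-distrib-+ {B} _ _ ⟩
      weightedTopLeft + topLeft      ≡⟨ cong (_+ topLeft) weightedTopLeft≡topRight ⟩
      topRight + topLeft             ≡⟨ +-comm topRight topLeft ⟩
      topLeft + topRight             ≡⟨ top-rows ⟩
      B * R                          ∎
      where
      *[n+1] : ∀ m n → m * (n + 1) ≡ m * n + m
      *[n+1] m n = trans (*-distribˡ-+ m n 1) (cong (m * n +_) (*-identityʳ m))

    ∣B*R : ∀ {w} → (∀ b → w ∣ blockSize inc b + 1) → w ∣ B * R
    ∣B*R w∣size+1 = subst (_ ∣_) sum-top-left[size+1]
      (∣-sum (λ i → ∣-sum (λ j → ∣n⇒∣m*n (A (top i) (top j)) (w∣size+1 (i ⊕ j)))))

  orthogonal-extension⇒∣B*R : ∀ {w} → (∀ b → w ∣ blockSize inc b + 1) →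
    (F : Square N 2) → IsFreqSquare N 2 (binaryType N R) F →
    (∀ x → Orthogonal (binaryType N R) (binaryType N R) F (binarySquare (square x))) →
    w ∣ B * R
  orthogonal-extension⇒∣B*R w∣size+1 F (_ , _ , rows , columns) F⊥squares =
    Extension.∣B*R ones (λ r → rows r (suc zero)) (λ c → columns c (suc zero)) ones⊥squares w∣size+1
    where
    ones : Fin N → Fin N → Bool
    ones r c = ⌊ F r c ≟ suc zero ⌋

    ones⊥squares : ∀ x → countCells N (λ r c → ones r c ∧ square x r c) ≡ R * R
    ones⊥squares x = trans (countCells-cong N (λ r c → cong (ones r c ∧_) (sym (⌊fromBool≟⌋ (square x r c) (suc zero)))))
                           (F⊥squares x (suc zero) (suc zero))

theorem5p2 : (R Λ w V B : ℕ) → 1 ≤ R → 1 ≤ Λ → 1 ≤ w →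
    (inc : Fin B → Fin V → Bool) → IsDK V B R Λ inc →
    (∀ (b : Fin B) → w ∣ (blockSize inc b + 1)) →
    (¬ (w ∣ R * B) ⊎ ¬ (w ∣ B * B)) →
    Σ (Fin V → Square (B + V * R) 2) λ Fs →
      IsMOFS (B + V * R) 2 (binaryType (B + V * R) R) V Fs
      × TypeMaximal (B + V * R) 2 (binaryType (B + V * R) R) V Fs
theorem5p2 R Λ w V B 1≤R _ _ inc (replication , pairs , R*R≡Λ*B) w∣size+1 w∤RB⊎w∤BB =
  Fs , (isFreqSquare , orthogonal) , typeMaximal
  where
  open Construction R inc

  Fs : Fin V → Square N 2
  Fs x = binarySquare (square x)

  isFreqSquare : ∀ x → IsFreqSquare N 2 (binaryType N R) (Fs x)
  isFreqSquare x = binarySquare-isFreqSquare (square x) 1≤R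
    (1≤B+V*R∸R V R {{nonZeroIndex x}} (R*R≡Λ*B⇒1≤B Λ B 1≤R R*R≡Λ*B))
    (square-rows replication x) (square-columns replication x)

  orthogonal : ∀ x y → x ≢ y → Orthogonal (binaryType N R) (binaryType N R) (Fs x) (Fs y)
  orthogonal x y x≢y = binarySquare-orthogonal (square x) (square y)
    (square-rows replication x) (square-rows replication y) (square-pairs x≢y (pairs x y x≢y) R*R≡Λ*B)

  typeMaximal : TypeMaximal N 2 (binaryType N R) V Fs
  typeMaximal (_ , F , isFreqSquareF , F⊥Fs) =
    [ (λ w∤RB → w∤RB (subst (w ∣_) (*-comm B R) w∣BR)) , (λ w∤BB → w∤BB (∣B*R⇒∣B*B inc replication w∣size+1 w∣BR)) ]′ w∤RB⊎w∤BB
    where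
    w∣BR : w ∣ B * R
    w∣BR = orthogonal-extension⇒∣B*R w∣size+1 F isFreqSquareF F⊥Fs
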